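{- Let $H(z)=\sum_{n=0}^\infty \frac{z^{6n}}{(6n)!}$ and let $H^{(3)}$ denote its third derivative. (1) For every integer $r>0$ there is a polynomial $P_r(z)$ such that $(H^{(3)})^2-H^2\equiv P_r(z)\pmod{3^r}$. (2) For every integer $r>0$ there is a polynomial $Q_r(z)$ such that $\dfrac{1}{H^3+3H(H^{(3)})^2}\equiv Q_r(z)\pmod{3^r}$.
   Context: For formal power series $f=\sum a_n z^n/n!$ and $g=\sum b_n z^n/n!$ with $a_n,b_n\in\mathbb{Z}_3$ (the $3$-adic integers), $f\equiv g\pmod{3^r}$ means $a_n\equiv b_n\pmod{3^r}$ for all $n\ge 0$. Here the series $1/(H^3+3H(H^{(3)})^2)$ is written in this exponential form, and a polynomial is regarded as such a series. -}

module Defs where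

open import Data.Nat using (ℕ; zero; suc; _∸_; _%_; _^_)
open import Data.Nat.Combinatorics using (_C_)
open import Data.Integer using (ℤ; +_; _+_; _*_; -_; _-_)
open import Data.Integer.Divisibility using (_∣_)
open import Data.List using (List; []; _∷_)

-- A formal power series f = Σ a_n z^n / n!, represented by its sequence of
-- EGF coefficients a_n.  All series in the statement have integer
-- coefficients, so we use ℤ.
EGF : Set
EGF = ℕ → ℤ

sumTo : ℕ → (ℕ → ℤ) → ℤ
sumTo zero    f = + 0
sumTo (suc n) f = sumTo n f + f n

infixl 7 _⊛_
_⊛_ : EGF → EGF → EGF
(f ⊛ g) n = sumTo (suc n) (λ k → + (n C k) * (f k * g (n ∸ k)))

infixl 6 _⊕_ _⊝_
_⊕_ : EGF → EGF → EGF
(f ⊕ g) n = f n + g n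

_⊝_ : EGF → EGF → EGF
(f ⊝ g) n = f n - g n

_·_ : ℤ → EGF → EGF
(c · f) n = c * f n

deriv : EGF → EGF
deriv f n = f (suc n)

deriv³ : EGF → EGF
deriv³ f = deriv (deriv (deriv f))

H : EGF
H n with n % 6
... | zero  = + 1
... | suc _ = + 0

nth : List ℤ → ℕ → ℤ
nth []       _       = + 0
nth (x ∷ xs) zero    = x
nth (x ∷ xs) (suc j) = nth xs j

-- Multiplicative inverse of a series with constant term 1:
-- b_0 = 1, b_m = - Σ_{k=1}^{m} C(m,k) a_k b_{m-k}.
-- invRev f n = [b_n, b_{n-1}, ..., b_0].
invRev : EGF → ℕ → List ℤ
invRev f zero    = + 1 ∷ []
invRev f (suc n) =
  (- sumTo (suc n) (λ j → + (suc n C suc j) * (f (suc j) * nth (invRev f n) j)))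
  ∷ invRev f n

-- 1/f, for f with f 0 = 1
inv : EGF → EGF
inv f n = nth (invRev f n) 0

-- a polynomial, given by its finitely many EGF coefficients a_0,...,a_d
-- (a_n = 0 beyond), regarded as a series
poly : List ℤ → EGF
poly = nth

_≡_[mod3^_] : EGF → EGF → ℕ → Set
f ≡ g [mod3^ r ] = ∀ n → (+ (3 ^ r)) ∣ (f n - g n)

-- H is fixed by the sixth derivative D⁶, so for each k the products of k of the derivatives
-- H, H′, …, H⁽⁵⁾ span a finite module on which D acts as the sum of the k cyclic shifts of the
-- derivative orders. Computing in that module (where the eigenvalues of D are sums of sixth roots
-- of unity) gives D¹³F = −27 D⁷F for F = (H‴)² − H² and D¹³G = 702 D⁷G + 3⁹ DG for
-- G = H³ + 3H(H‴)². Since 3 ∣ 27, 3 ∣ 702 and 3² ∣ 3⁹, the coefficients gain a factor 3 every six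
-- steps: 3^⌊n/6⌋ divides F₍ₙ₊₁₎ and 3^(2+⌊n/6⌋) divides G₍ₙ₊₁₎. The recursion for the coefficients
-- of 1/G then gives 3^⌊n/6⌋ ∣ (1/G)ₙ, as ⌊(i+j+1)/6⌋ ≤ 1 + ⌊i/6⌋ + ⌊j/6⌋. Cutting F and 1/G off
-- where their coefficients become divisible by 3ʳ gives Pᵣ and Qᵣ.
module Submission where

open import Defs
open import Data.Nat using (ℕ; _<_)
open import Data.Integer using (+_)
open import Data.List using (List)
open import Data.Product using (_×_; ∃)

open import Algebra.Properties.CommutativeSemigroup as CommSemigroupProperties using ()
open import Data.Fin using (Fin; toℕ; #_)
open import Data.Integer as ℤ using (ℤ; _+_; _*_; -_; _-_; _^_)
open import Data.Integer.Divisibility.Signed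
  using (_∣_; divides; _∣?_; ∣⇒∣ᵤ; ∣-refl; ∣-trans; ∣m∣n⇒∣m+n; ∣m⇒∣-m; ∣m⇒∣m*n; ∣n⇒∣m*n; *-monoˡ-∣; *-monoʳ-∣)
import Data.Integer.Properties as ℤ
open import Data.Integer.Tactic.RingSolver using (solve-∀)
open import Data.List using (applyUpTo)
open import Data.Nat as ℕ using (zero; suc; _∸_; _≤_; z≤n; s≤s; NonZero; _/_; _%_)
open import Data.Nat.Combinatorics using (_C_; nCk+nC[k+1]≡[n+1]C[k+1]; k>n⇒nCk≡0)
open import Data.Nat.DivMod
  using (m≡m%n+[m/n]*n; m%n<n; m<n*o⇒m/o<n; +-distrib-/-∣ˡ; m*n/n≡m; 0/n≡0; /-monoˡ-≤; [m+n]%n≡m%n)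
open import Data.Nat.Divisibility using (n∣m*n)
open import Data.Nat.GeneralisedArithmetic using (iterate)
open import Data.Nat.Induction using (<-rec)
import Data.Nat.Properties as ℕ
open import Data.Product using (_,_; proj₂)
open import Data.Unit using (tt)
open import Data.Vec using (Vec; []; _∷_; _∷ʳ_; replicate; map; zipWith; last; init; initLast; _[_]≔_)
import Data.Vec.Properties as Vec
open import Relation.Binary.Definitions using (DecidableEquality)
open import Relation.Binary.PropositionalEquality
open import Relation.Nullary using (yes; no)
open import Relation.Nullary.Decidable using (toWitness)

private
  module ℕ+ = CommSemigroupProperties ℕ.+-commutativeSemigroup
  module ℤ+ = CommSemigroupProperties ℤ.+-commutativeSemigroup

  variable
    A B : Set

zeroₑ : EGF
zeroₑ _ = + 0

constant : ℤ → EGF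
constant c zero    = c
constant c (suc _) = + 0

sumTo-cong : ∀ n {f g : ℕ → ℤ} → (∀ {k} → k < n → f k ≡ g k) → sumTo n f ≡ sumTo n g
sumTo-cong zero    eq = refl
sumTo-cong (suc n) eq = cong₂ _+_ (sumTo-cong n (λ k<n → eq (ℕ.m<n⇒m<1+n k<n))) (eq ℕ.≤-refl)

sumTo-distrib-+ : ∀ n (f g : ℕ → ℤ) → sumTo n (λ k → f k + g k) ≡ sumTo n f + sumTo n g
sumTo-distrib-+ zero    f g = refl
sumTo-distrib-+ (suc n) f g rewrite sumTo-distrib-+ n f g = ℤ+.interchange (sumTo n f) (sumTo n g) (f n) (g n)

sumTo-distrib-* : ∀ n c (f : ℕ → ℤ) → sumTo n (λ k → c * f k) ≡ c * sumTo n f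
sumTo-distrib-* zero    c f = sym (ℤ.*-zeroʳ c)
sumTo-distrib-* (suc n) c f rewrite sumTo-distrib-* n c f = sym (ℤ.*-distribˡ-+ c (sumTo n f) (f n))

sumTo-zero : ∀ n → sumTo n (λ _ → + 0) ≡ + 0
sumTo-zero n = sumTo-distrib-* n (+ 0) zeroₑ

sumTo-suc : ∀ n (f : ℕ → ℤ) → sumTo (suc n) f ≡ f 0 + sumTo n (λ k → f (suc k))
sumTo-suc zero    f = ℤ.+-comm (+ 0) (f 0)
sumTo-suc (suc n) f rewrite sumTo-suc n f = ℤ.+-assoc (f 0) _ _

deriv-⊛ : ∀ f g → deriv (f ⊛ g) ≗ deriv f ⊛ g ⊕ f ⊛ deriv g
deriv-⊛ f g n = begin
  (f ⊛ g) (suc n)                                         ≡⟨ sumTo-suc (suc n) _ ⟩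
  head + sumTo (suc n) (λ k → + (suc n C suc k) * X k)    ≡⟨ cong (_+_ head) pascal ⟩
  head + ((deriv f ⊛ g) n + sumTo (suc n) Y)              ≡⟨ cong (λ s → head + ((deriv f ⊛ g) n + s)) drop-last ⟩
  head + ((deriv f ⊛ g) n + tail)                         ≡⟨ ℤ+.x∙yz≈y∙xz head ((deriv f ⊛ g) n) tail ⟩
  (deriv f ⊛ g) n + (head + tail)                         ≡⟨ cong (_+_ ((deriv f ⊛ g) n)) (sumTo-suc n _) ⟨
  (deriv f ⊛ g ⊕ f ⊛ deriv g) n                           ∎
  where
  open ≡-Reasoning
  head = + 1 * (f 0 * g (suc n))
  X Y : ℕ → ℤ
  X k = f (suc k) * g (n ∸ k)
  Y k = + (n C suc k) * X k
  tail = sumTo n (λ k → + (n C suc k) * (f (suc k) * g (suc (n ∸ suc k))))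
  pascal : sumTo (suc n) (λ k → + (suc n C suc k) * X k) ≡ (deriv f ⊛ g) n + sumTo (suc n) Y
  pascal = trans (sumTo-cong (suc n) λ {k} _ → trans
                   (cong (λ c → + c * X k) (sym (nCk+nC[k+1]≡[n+1]C[k+1] n k)))
                   (ℤ.*-distribʳ-+ (X k) (+ (n C k)) (+ (n C suc k))))
                 (sumTo-distrib-+ (suc n) _ Y)
  drop-last : sumTo (suc n) Y ≡ tail
  drop-last = begin
    sumTo n Y + Y n   ≡⟨ cong (λ c → sumTo n Y + + c * X n) (k>n⇒nCk≡0 (ℕ.n<1+n n)) ⟩
    sumTo n Y + + 0   ≡⟨ ℤ.+-identityʳ _ ⟩
    sumTo n Y         ≡⟨ sumTo-cong n (λ {k} k<n → cong (λ m → + (n C suc k) * (f (suc k) * g m))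
                                                   (ℕ.+-∸-assoc 1 k<n)) ⟩
    tail              ∎

⊛-congˡ : ∀ {f f′} g → f ≗ f′ → f ⊛ g ≗ f′ ⊛ g
⊛-congˡ g eq n = sumTo-cong (suc n) λ {k} _ → cong (λ a → + (n C k) * (a * g (n ∸ k))) (eq k)

⊛-congʳ : ∀ f {g g′} → g ≗ g′ → f ⊛ g ≗ f ⊛ g′
⊛-congʳ f eq n = sumTo-cong (suc n) λ {k} _ → cong (λ b → + (n C k) * (f k * b)) (eq (n ∸ k))

⊛-distribʳ-⊕ : ∀ h f g → (f ⊕ g) ⊛ h ≗ f ⊛ h ⊕ g ⊛ h
⊛-distribʳ-⊕ h f g n = trans
  (sumTo-cong (suc n) λ {k} _ → distrib (+ (n C k)) (f k) (g k) (h (n ∸ k)))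
  (sumTo-distrib-+ (suc n) _ _)
  where
  distrib : ∀ c a b x → c * ((a + b) * x) ≡ c * (a * x) + c * (b * x)
  distrib = solve-∀

⊛-distribˡ-⊕ : ∀ h f g → h ⊛ (f ⊕ g) ≗ h ⊛ f ⊕ h ⊛ g
⊛-distribˡ-⊕ h f g n = trans
  (sumTo-cong (suc n) λ {k} _ → distrib (+ (n C k)) (h k) (f (n ∸ k)) (g (n ∸ k)))
  (sumTo-distrib-+ (suc n) _ _)
  where
  distrib : ∀ c x a b → c * (x * (a + b)) ≡ c * (x * a) + c * (x * b)
  distrib = solve-∀

·-⊛-assoc : ∀ c f g → (c · f) ⊛ g ≗ c · (f ⊛ g)
·-⊛-assoc c f g n = trans
  (sumTo-cong (suc n) λ {k} _ → reassoc c (+ (n C k)) (f k) (g (n ∸ k)))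
  (sumTo-distrib-* (suc n) c _)
  where
  reassoc : ∀ c b x y → b * (c * x * y) ≡ c * (b * (x * y))
  reassoc = solve-∀

constant-⊛ : ∀ c f → constant c ⊛ f ≗ c · f
constant-⊛ c f n = begin
  (constant c ⊛ f) n            ≡⟨ sumTo-suc n _ ⟩
  + 1 * (c * f n) + sumTo n Z   ≡⟨ cong₂ _+_ (ℤ.*-identityˡ (c * f n)) vanish ⟩
  c * f n + + 0                 ≡⟨ ℤ.+-identityʳ _ ⟩
  c * f n                       ∎
  where
  open ≡-Reasoning
  Z : ℕ → ℤ
  Z k = + (n C suc k) * (+ 0 * f (n ∸ suc k))
  vanish : sumTo n Z ≡ + 0
  vanish = trans (sumTo-cong n λ {k} _ → trans (cong (_*_ (+ (n C suc k))) (ℤ.*-zeroˡ (f (n ∸ suc k))))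
                                               (ℤ.*-zeroʳ (+ (n C suc k))))
                 (sumTo-zero n)

⊛-identityˡ : ∀ g → constant (+ 1) ⊛ g ≗ g
⊛-identityˡ g n = trans (constant-⊛ (+ 1) g n) (ℤ.*-identityˡ (g n))

⊛-zeroˡ : ∀ g → zeroₑ ⊛ g ≗ zeroₑ
⊛-zeroˡ g n = trans (⊛-congˡ g zeroₑ≗constant n) (trans (constant-⊛ (+ 0) g n) (ℤ.*-zeroˡ (g n)))
  where
  zeroₑ≗constant : zeroₑ ≗ constant (+ 0)
  zeroₑ≗constant zero    = refl
  zeroₑ≗constant (suc _) = refl

⊛-comm : ∀ f g → f ⊛ g ≗ g ⊛ f
⊛-comm f g zero    = cong (λ a → + 0 + + 1 * a) (ℤ.*-comm (f 0) (g 0))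
⊛-comm f g (suc n) = begin
  (f ⊛ g) (suc n)                      ≡⟨ deriv-⊛ f g n ⟩
  (deriv f ⊛ g) n + (f ⊛ deriv g) n    ≡⟨ cong₂ _+_ (⊛-comm (deriv f) g n) (⊛-comm f (deriv g) n) ⟩
  (g ⊛ deriv f) n + (deriv g ⊛ f) n    ≡⟨ ℤ.+-comm ((g ⊛ deriv f) n) _ ⟩
  (deriv g ⊛ f) n + (g ⊛ deriv f) n    ≡⟨ deriv-⊛ g f n ⟨
  (g ⊛ f) (suc n)                      ∎
  where open ≡-Reasoning

⊛-assoc : ∀ f g h → (f ⊛ g) ⊛ h ≗ f ⊛ (g ⊛ h)
⊛-assoc f g h zero    = reassoc (f 0) (g 0) (h 0)
  where
  reassoc : ∀ x y z → + 0 + + 1 * ((+ 0 + + 1 * (x * y)) * z) ≡ + 0 + + 1 * (x * (+ 0 + + 1 * (y * z)))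
  reassoc = solve-∀
⊛-assoc f g h (suc n) = begin
  ((f ⊛ g) ⊛ h) (suc n)
    ≡⟨ deriv-⊛ (f ⊛ g) h n ⟩
  (deriv (f ⊛ g) ⊛ h) n + ((f ⊛ g) ⊛ deriv h) n
    ≡⟨ cong (_+ ((f ⊛ g) ⊛ deriv h) n)
         (trans (⊛-congˡ h (deriv-⊛ f g) n) (⊛-distribʳ-⊕ h (deriv f ⊛ g) (f ⊛ deriv g) n)) ⟩
  ((deriv f ⊛ g) ⊛ h) n + ((f ⊛ deriv g) ⊛ h) n + ((f ⊛ g) ⊛ deriv h) n
    ≡⟨ cong₂ _+_ (cong₂ _+_ (⊛-assoc (deriv f) g h n) (⊛-assoc f (deriv g) h n)) (⊛-assoc f g (deriv h) n) ⟩
  (deriv f ⊛ (g ⊛ h)) n + (f ⊛ (deriv g ⊛ h)) n + (f ⊛ (g ⊛ deriv h)) n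
    ≡⟨ ℤ.+-assoc ((deriv f ⊛ (g ⊛ h)) n) _ _ ⟩
  (deriv f ⊛ (g ⊛ h)) n + ((f ⊛ (deriv g ⊛ h)) n + (f ⊛ (g ⊛ deriv h)) n)
    ≡⟨ cong (_+_ ((deriv f ⊛ (g ⊛ h)) n))
         (trans (⊛-congʳ f (deriv-⊛ g h) n) (⊛-distribˡ-⊕ f (deriv g ⊛ h) (g ⊛ deriv h) n)) ⟨
  (deriv f ⊛ (g ⊛ h)) n + (f ⊛ deriv (g ⊛ h)) n
    ≡⟨ deriv-⊛ f (g ⊛ h) n ⟨
  (f ⊛ (g ⊛ h)) (suc n) ∎
  where open ≡-Reasoning

rotate : ∀ {m} → Vec A m → Vec A m
rotate []        = []
rotate v@(_ ∷ _) = last v ∷ init v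

contract : (A → EGF) → EGF → ∀ {m} → Vec A m → EGF
contract e g []       = zeroₑ
contract e g (t ∷ ts) = e t ⊛ g ⊕ contract e (deriv g) ts

contract-cong : ∀ {e e′ : A → EGF} g → (∀ t → e t ≗ e′ t) → ∀ {m} (v : Vec A m) →
                contract e g v ≗ contract e′ g v
contract-cong g eq []       n = refl
contract-cong g eq (t ∷ ts) n = cong₂ _+_ (⊛-congˡ g (eq t) n) (contract-cong (deriv g) eq ts n)

contract-map : ∀ (e : A → EGF) (φ : B → A) g {m} (v : Vec B m) →
               contract e g (map φ v) ≗ contract (λ t → e (φ t)) g v
contract-map e φ g []       n = refl
contract-map e φ g (t ∷ ts) n = cong (_+_ ((e (φ t) ⊛ g) n)) (contract-map e φ (deriv g) ts n)

contract-zipWith : ∀ (e : A → EGF) (_∙_ : A → A → A) → (∀ a b → e (a ∙ b) ≗ e a ⊕ e b) →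
                   ∀ g {m} (u v : Vec A m) → contract e g (zipWith _∙_ u v) ≗ contract e g u ⊕ contract e g v
contract-zipWith e _∙_ e-hom g []       []       n = refl
contract-zipWith e _∙_ e-hom g (a ∷ u) (b ∷ v) n = begin
  (e (a ∙ b) ⊛ g) n + contract e (deriv g) (zipWith _∙_ u v) n
    ≡⟨ cong₂ _+_ (trans (⊛-congˡ g (e-hom a b) n) (⊛-distribʳ-⊕ g (e a) (e b) n))
                 (contract-zipWith e _∙_ e-hom (deriv g) u v n) ⟩
  (e a ⊛ g) n + (e b ⊛ g) n + (contract e (deriv g) u n + contract e (deriv g) v n)
    ≡⟨ ℤ+.interchange ((e a ⊛ g) n) ((e b ⊛ g) n) (contract e (deriv g) u n) (contract e (deriv g) v n) ⟩
  (e a ⊛ g) n + contract e (deriv g) u n + ((e b ⊛ g) n + contract e (deriv g) v n) ∎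
  where open ≡-Reasoning

contract-map-· : ∀ (e : A → EGF) (φ : A → A) c → (∀ a → e (φ a) ≗ c · e a) →
                     ∀ g {m} (v : Vec A m) → contract e g (map φ v) ≗ c · contract e g v
contract-map-· e φ c e-hom g []       n = sym (ℤ.*-zeroʳ c)
contract-map-· e φ c e-hom g (a ∷ v) n = begin
  (e (φ a) ⊛ g) n + contract e (deriv g) (map φ v) n
    ≡⟨ cong₂ _+_ (trans (⊛-congˡ g (e-hom a) n) (·-⊛-assoc c (e a) g n))
                 (contract-map-· e φ c e-hom (deriv g) v n) ⟩
  c * (e a ⊛ g) n + c * contract e (deriv g) v n
    ≡⟨ ℤ.*-distribˡ-+ c ((e a ⊛ g) n) (contract e (deriv g) v n) ⟨
  c * ((e a ⊛ g) n + contract e (deriv g) v n) ∎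
  where open ≡-Reasoning

contract-replicate : ∀ (e : A → EGF) z → e z ≗ zeroₑ → ∀ g m → contract e g (replicate m z) ≗ zeroₑ
contract-replicate e z ez≗0 g zero    n = refl
contract-replicate e z ez≗0 g (suc m) n =
  cong₂ _+_ (trans (⊛-congˡ g ez≗0 n) (⊛-zeroˡ g n)) (contract-replicate e z ez≗0 (deriv g) m n)

contract-replicate-[]≔ : ∀ (e : A → EGF) z → e z ≗ zeroₑ → ∀ g {m} (i : Fin m) t →
                  contract e g (replicate m z [ i ]≔ t) ≗ e t ⊛ iterate deriv g (toℕ i)
contract-replicate-[]≔ e z ez≗0 g {suc m} Fin.zero t n =
  trans (cong (_+_ ((e t ⊛ g) n)) (contract-replicate e z ez≗0 (deriv g) m n)) (ℤ.+-identityʳ ((e t ⊛ g) n))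
contract-replicate-[]≔ e z ez≗0 g {suc m} (Fin.suc i) t n =
  trans (cong₂ _+_ (trans (⊛-congˡ g ez≗0 n) (⊛-zeroˡ g n)) (contract-replicate-[]≔ e z ez≗0 (deriv g) i t n))
        (ℤ.+-identityˡ ((e t ⊛ iterate deriv g (suc (toℕ i))) n))

deriv-contract : ∀ e g {m} (v : Vec A m) →
                 deriv (contract e g v) ≗ contract (λ t → deriv (e t)) g v ⊕ contract e (deriv g) v
deriv-contract e g []       n = refl
deriv-contract e g (t ∷ ts) n = begin
  (e t ⊛ g) (suc n) + contract e g′ ts (suc n)
    ≡⟨ cong₂ _+_ (deriv-⊛ (e t) g n) (deriv-contract e g′ ts n) ⟩
  (e′ t ⊛ g) n + (e t ⊛ g′) n + (contract e′ g′ ts n + contract e (deriv g′) ts n)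
    ≡⟨ ℤ+.interchange ((e′ t ⊛ g) n) ((e t ⊛ g′) n) (contract e′ g′ ts n) (contract e (deriv g′) ts n) ⟩
  (e′ t ⊛ g) n + contract e′ g′ ts n + ((e t ⊛ g′) n + contract e (deriv g′) ts n) ∎
  where
  open ≡-Reasoning
  e′ = λ t → deriv (e t)
  g′ = deriv g

contract-∷ʳ : ∀ e g {m} (v : Vec A m) t →
              contract e g (v ∷ʳ t) ≗ contract e g v ⊕ e t ⊛ iterate deriv g m
contract-∷ʳ e g []       t n = trans (ℤ.+-identityʳ ((e t ⊛ g) n)) (sym (ℤ.+-identityˡ ((e t ⊛ g) n)))
contract-∷ʳ e g {suc m} (s ∷ ss) t n =
  trans (cong (_+_ ((e s ⊛ g) n)) (contract-∷ʳ e (deriv g) ss t n))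
        (sym (ℤ.+-assoc ((e s ⊛ g) n) (contract e (deriv g) ss n) ((e t ⊛ iterate deriv g (suc m)) n)))

contract-rotate : ∀ e g {m} → iterate deriv g m ≗ g → (v : Vec A m) →
                  contract e (deriv g) v ≗ contract e g (rotate v)
contract-rotate e g periodic []          n = refl
contract-rotate e g {suc m} periodic v@(_ ∷ _) n = begin
  contract e (deriv g) v n
    ≡⟨ cong (λ w → contract e (deriv g) w n) (proj₂ (proj₂ (initLast v))) ⟩
  contract e (deriv g) (init v ∷ʳ last v) n
    ≡⟨ contract-∷ʳ e (deriv g) (init v) (last v) n ⟩
  contract e (deriv g) (init v) n + (e (last v) ⊛ iterate deriv g (suc m)) n
    ≡⟨ ℤ.+-comm (contract e (deriv g) (init v) n) _ ⟩
  (e (last v) ⊛ iterate deriv g (suc m)) n + contract e (deriv g) (init v) n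
    ≡⟨ cong (_+ contract e (deriv g) (init v) n) (⊛-congʳ (e (last v)) periodic n) ⟩
  contract e g (rotate v) n ∎
  where open ≡-Reasoning

Tensor : ℕ → ℕ → Set
Tensor p zero    = ℤ
Tensor p (suc k) = Vec (Tensor p k) p

module _ {p : ℕ} where

  0ᵀ : ∀ k → Tensor p k
  0ᵀ zero    = + 0
  0ᵀ (suc k) = replicate p (0ᵀ k)

  infixl 6 _⊞_
  _⊞_ : ∀ {k} → Tensor p k → Tensor p k → Tensor p k
  _⊞_ {zero}  a b = a + b
  _⊞_ {suc k} u v = zipWith _⊞_ u v

  infixl 7 _⊠_
  _⊠_ : ∀ {k} → ℤ → Tensor p k → Tensor p k
  _⊠_ {zero}  c a = c * a
  _⊠_ {suc k} c v = map (c ⊠_) v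

  _≟ᵀ_ : ∀ {k} → DecidableEquality (Tensor p k)
  _≟ᵀ_ {zero}  = ℤ._≟_
  _≟ᵀ_ {suc k} = Vec.≡-dec _≟ᵀ_

  basis : ∀ {k} → Vec (Fin p) k → Tensor p k
  basis []               = + 1
  basis {suc k} (i ∷ is) = replicate p (0ᵀ k) [ i ]≔ basis is

  derivᵀ : ∀ k → Tensor p k → Tensor p k
  derivᵀ zero    c = + 0
  derivᵀ (suc k) v = map (derivᵀ k) v ⊞ rotate v

module Monomials (f : EGF) (p : ℕ) (periodic : iterate deriv f p ≗ f) where

  eval : ∀ k → Tensor p k → EGF
  eval zero    c = constant c
  eval (suc k) v = contract (eval k) f v

  f⁽_⁾ : ℕ → EGF
  f⁽ i ⁾ = iterate deriv f i

  monomial : ∀ {k} → Vec (Fin p) k → EGF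
  monomial []       = constant (+ 1)
  monomial (i ∷ is) = monomial is ⊛ f⁽ toℕ i ⁾

  eval-⊞ : ∀ k (u v : Tensor p k) → eval k (u ⊞ v) ≗ eval k u ⊕ eval k v
  eval-⊞ zero    a b zero    = refl
  eval-⊞ zero    a b (suc n) = refl
  eval-⊞ (suc k) u v         = contract-zipWith (eval k) _⊞_ (eval-⊞ k) f u v

  eval-⊠ : ∀ k c (v : Tensor p k) → eval k (c ⊠ v) ≗ c · eval k v
  eval-⊠ zero    c a zero    = refl
  eval-⊠ zero    c a (suc n) = sym (ℤ.*-zeroʳ c)
  eval-⊠ (suc k) c v         = contract-map-· (eval k) (c ⊠_) c (eval-⊠ k c) f v

  eval-0ᵀ : ∀ k → eval k (0ᵀ k) ≗ zeroₑ
  eval-0ᵀ zero    zero    = refl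
  eval-0ᵀ zero    (suc n) = refl
  eval-0ᵀ (suc k)         = contract-replicate (eval k) (0ᵀ k) (eval-0ᵀ k) f p

  eval-basis : ∀ {k} (is : Vec (Fin p) k) → eval k (basis is) ≗ monomial is
  eval-basis []               n = refl
  eval-basis {suc k} (i ∷ is) n = trans
    (contract-replicate-[]≔ (eval k) (0ᵀ k) (eval-0ᵀ k) f i (basis is) n)
    (⊛-congˡ f⁽ toℕ i ⁾ (eval-basis is) n)

  eval-basis₂ : ∀ i j → eval 2 (basis (j ∷ i ∷ [])) ≗ f⁽ toℕ i ⁾ ⊛ f⁽ toℕ j ⁾
  eval-basis₂ i j n = trans (eval-basis (j ∷ i ∷ []) n) (⊛-congˡ f⁽ toℕ j ⁾ (⊛-identityˡ f⁽ toℕ i ⁾) n)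

  eval-basis₃ : ∀ i j k → eval 3 (basis (k ∷ j ∷ i ∷ [])) ≗ f⁽ toℕ i ⁾ ⊛ f⁽ toℕ j ⁾ ⊛ f⁽ toℕ k ⁾
  eval-basis₃ i j k n = trans (eval-basis (k ∷ j ∷ i ∷ []) n)
    (⊛-congˡ f⁽ toℕ k ⁾ (⊛-congˡ f⁽ toℕ j ⁾ (⊛-identityˡ f⁽ toℕ i ⁾)) n)

  deriv-eval : ∀ k (v : Tensor p k) → deriv (eval k v) ≗ eval k (derivᵀ k v)
  deriv-eval zero    c zero    = refl
  deriv-eval zero    c (suc n) = refl
  deriv-eval (suc k) v n = begin
    deriv (contract (eval k) f v) n
      ≡⟨ deriv-contract (eval k) f v n ⟩
    contract (λ t → deriv (eval k t)) f v n + contract (eval k) (deriv f) v n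
      ≡⟨ cong₂ _+_ (contract-cong f (deriv-eval k) v n) (contract-rotate (eval k) f periodic v n) ⟩
    contract (λ t → eval k (derivᵀ k t)) f v n + contract (eval k) f (rotate v) n
      ≡⟨ cong (_+ contract (eval k) f (rotate v) n) (contract-map (eval k) (derivᵀ k) f v n) ⟨
    contract (eval k) f (map (derivᵀ k) v) n + contract (eval k) f (rotate v) n
      ≡⟨ eval-⊞ (suc k) (map (derivᵀ k) v) (rotate v) n ⟨
    eval (suc k) (derivᵀ (suc k) v) n ∎
    where open ≡-Reasoning

  eval-iterate : ∀ k (v : Tensor p k) j n → eval k v (j ℕ.+ n) ≡ eval k (iterate (derivᵀ k) v j) n
  eval-iterate k v zero    n = refl
  eval-iterate k v (suc j) n = trans (deriv-eval k v (j ℕ.+ n)) (eval-iterate k (derivᵀ k v) j n)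

  recurrence-from-tensor : ∀ k (v : Tensor p k) {s} → eval k v ≗ s → ∀ i j l a b →
    iterate (derivᵀ k) v i ≡ a ⊠ iterate (derivᵀ k) v j ⊞ b ⊠ iterate (derivᵀ k) v l →
    ∀ n → s (i ℕ.+ n) ≡ a * s (j ℕ.+ n) + b * s (l ℕ.+ n)
  recurrence-from-tensor k v {s} v≗s i j l a b relation n = begin
    s (i ℕ.+ n)
      ≡⟨ trans (sym (v≗s (i ℕ.+ n))) (eval-iterate k v i n) ⟩
    eval k (iterate (derivᵀ k) v i) n
      ≡⟨ cong (λ w → eval k w n) relation ⟩
    eval k (a ⊠ vʲ ⊞ b ⊠ vˡ) n
      ≡⟨ eval-⊞ k (a ⊠ vʲ) (b ⊠ vˡ) n ⟩
    eval k (a ⊠ vʲ) n + eval k (b ⊠ vˡ) n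
      ≡⟨ cong₂ _+_ (eval-⊠ k a vʲ n) (eval-⊠ k b vˡ n) ⟩
    a * eval k vʲ n + b * eval k vˡ n
      ≡⟨ cong₂ (λ x y → a * x + b * y) (trans (sym (eval-iterate k v j n)) (v≗s (j ℕ.+ n)))
                                         (trans (sym (eval-iterate k v l n)) (v≗s (l ℕ.+ n))) ⟩
    a * s (j ℕ.+ n) + b * s (l ℕ.+ n) ∎
    where
    open ≡-Reasoning
    vʲ = iterate (derivᵀ k) v j
    vˡ = iterate (derivᵀ k) v l

module _ (p : ℕ) .{{_ : NonZero p}} where

  [k*p+m]/p≡k+m/p : ∀ k m → (k ℕ.* p ℕ.+ m) / p ≡ k ℕ.+ m / p
  [k*p+m]/p≡k+m/p k m = trans (+-distrib-/-∣ˡ m (n∣m*n k)) (cong (ℕ._+ m / p) (m*n/n≡m k p))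

  m*p≤n⇒m≤n/p : ∀ m {n} → m ℕ.* p ≤ n → m ≤ n / p
  m*p≤n⇒m≤n/p m m*p≤n = subst (_≤ _) (m*n/n≡m m p) (/-monoˡ-≤ p m*p≤n)

  m<[1+m/p]*p : ∀ m → m < suc (m / p) ℕ.* p
  m<[1+m/p]*p m = begin-strict
    m                      ≡⟨ m≡m%n+[m/n]*n m p ⟩
    m % p ℕ.+ m / p ℕ.* p  <⟨ ℕ.+-monoˡ-< (m / p ℕ.* p) (m%n<n m p) ⟩
    p ℕ.+ m / p ℕ.* p      ∎
    where open ℕ.≤-Reasoning

  [1+m+n]/p≤1+m/p+n/p : ∀ m n → suc (m ℕ.+ n) / p ≤ suc (m / p ℕ.+ n / p)
  [1+m+n]/p≤1+m/p+n/p m n = ℕ.<⇒≤pred (m<n*o⇒m/o<n (begin-strict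
    suc (m ℕ.+ n)                                  <⟨ ℕ.n<1+n (suc (m ℕ.+ n)) ⟩
    suc (suc (m ℕ.+ n))                            ≡⟨ cong suc (ℕ.+-suc m n) ⟨
    suc m ℕ.+ suc n                                ≤⟨ ℕ.+-mono-≤ (m<[1+m/p]*p m) (m<[1+m/p]*p n) ⟩
    suc (m / p) ℕ.* p ℕ.+ suc (n / p) ℕ.* p        ≡⟨ ℕ.*-distribʳ-+ p (suc (m / p)) (suc (n / p)) ⟨
    (suc (m / p) ℕ.+ suc (n / p)) ℕ.* p            ≡⟨ cong (ℕ._* p) (cong suc (ℕ.+-suc (m / p) (n / p))) ⟩
    suc (suc (m / p ℕ.+ n / p)) ℕ.* p              ∎))
    where open ℕ.≤-Reasoning

module _ (d : ℤ) where

  ^-monoʳ-∣ : ∀ {i j} → i ≤ j → d ^ i ∣ d ^ j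
  ^-monoʳ-∣ {i} {j} i≤j = subst (d ^ i ∣_) split (∣m⇒∣m*n (d ^ (j ∸ i)) ∣-refl)
    where
    split : d ^ i * d ^ (j ∸ i) ≡ d ^ j
    split = trans (sym (ℤ.^-distribˡ-+-* d i (j ∸ i))) (cong (d ^_) (ℕ.m+[n∸m]≡n i≤j))

  ^-∣-weaken : ∀ {i j x} → i ≤ j → d ^ j ∣ x → d ^ i ∣ x
  ^-∣-weaken i≤j = ∣-trans (^-monoʳ-∣ i≤j)

  ^-∣-* : ∀ i j {x y} → d ^ i ∣ x → d ^ j ∣ y → d ^ (i ℕ.+ j) ∣ x * y
  ^-∣-* i j {x} {y} dⁱ∣x dʲ∣y = subst (_∣ x * y) (sym (ℤ.^-distribˡ-+-* d i j))
    (∣-trans (*-monoˡ-∣ (d ^ j) dⁱ∣x) (*-monoʳ-∣ x dʲ∣y))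

∣-sumTo : ∀ {a} n (f : ℕ → ℤ) → (∀ {k} → k < n → a ∣ f k) → a ∣ sumTo n f
∣-sumTo {a} zero f a∣f = divides (+ 0) (sym (ℤ.*-zeroˡ a))
∣-sumTo (suc n) f a∣f = ∣m∣n⇒∣m+n (∣-sumTo n f (λ k<n → a∣f (ℕ.m<n⇒m<1+n k<n))) (a∣f ℕ.≤-refl)

nth-invRev : ∀ f {n j} → j ≤ n → nth (invRev f n) j ≡ inv f (n ∸ j)
nth-invRev f {zero}  z≤n       = refl
nth-invRev f {suc n} z≤n       = refl
nth-invRev f {suc n} (s≤s j≤n) = nth-invRev f j≤n

inv-suc : ∀ f n → inv f (suc n) ≡ - sumTo (suc n) (λ j → + (suc n C suc j) * (f (suc j) * inv f (n ∸ j)))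
inv-suc f n = cong -_ (sumTo-cong (suc n) λ {j} j<1+n →
  cong (λ b → + (suc n C suc j) * (f (suc j) * b)) (nth-invRev f (ℕ.≤-pred j<1+n)))

module _ (d : ℤ) (p : ℕ) .{{_ : NonZero p}} where

  ^-∣-second-order-recurrence :
    ∀ e (s : ℕ → ℤ) a b → d ∣ a → d ^ 2 ∣ b →
    (∀ n → s (2 ℕ.* p ℕ.+ n) ≡ a * s (1 ℕ.* p ℕ.+ n) + b * s n) →
    (∀ {n} → n < 2 ℕ.* p → d ^ (e ℕ.+ n / p) ∣ s n) →
    ∀ n → d ^ (e ℕ.+ n / p) ∣ s n
  ^-∣-second-order-recurrence e s a b d∣a d²∣b recurrence initial = <-rec P step
    where
    P : ℕ → Set
    P n = d ^ (e ℕ.+ n / p) ∣ s n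

    exponent : ∀ k m → e ℕ.+ (k ℕ.* p ℕ.+ m) / p ≡ k ℕ.+ (e ℕ.+ m / p)
    exponent k m = trans (cong (e ℕ.+_) ([k*p+m]/p≡k+m/p p k m)) (ℕ+.x∙yz≈y∙xz e k (m / p))

    [k*p+m]<[[1+k]*p+m] : ∀ k m → k ℕ.* p ℕ.+ m < suc k ℕ.* p ℕ.+ m
    [k*p+m]<[[1+k]*p+m] k m = ℕ.+-monoˡ-< m (ℕ.*-monoˡ-< p (ℕ.n<1+n k))

    advance : ∀ m → (∀ {k} → k < 2 ℕ.* p ℕ.+ m → P k) → P (2 ℕ.* p ℕ.+ m)
    advance m rec = subst (λ k → d ^ k ∣ s (2 ℕ.* p ℕ.+ m)) (sym (exponent 2 m))
      (subst (d ^ (2 ℕ.+ (e ℕ.+ m / p)) ∣_) (sym (recurrence m))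
        (∣m∣n⇒∣m+n (^-∣-* d 1 (1 ℕ.+ (e ℕ.+ m / p)) d¹∣a P[p+m]) (^-∣-* d 2 (e ℕ.+ m / p) d²∣b P[m])))
      where
      d¹∣a : d ^ 1 ∣ a
      d¹∣a = subst (_∣ a) (sym (ℤ.*-identityʳ d)) d∣a
      P[p+m] : d ^ (1 ℕ.+ (e ℕ.+ m / p)) ∣ s (1 ℕ.* p ℕ.+ m)
      P[p+m] = subst (λ k → d ^ k ∣ s (1 ℕ.* p ℕ.+ m)) (exponent 1 m) (rec ([k*p+m]<[[1+k]*p+m] 1 m))
      P[m] : P m
      P[m] = rec (ℕ.<-trans ([k*p+m]<[[1+k]*p+m] 0 m) ([k*p+m]<[[1+k]*p+m] 1 m))

    step : ∀ n → (∀ {m} → m < n → P m) → P n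
    step n rec with n ℕ.<? 2 ℕ.* p
    ... | yes n<2p = initial n<2p
    ... | no  n≮2p = subst P n≡ (advance (n ∸ 2 ℕ.* p) (λ k<n → rec (subst (_ <_) n≡ k<n)))
      where
      n≡ : 2 ℕ.* p ℕ.+ (n ∸ 2 ℕ.* p) ≡ n
      n≡ = ℕ.m+[n∸m]≡n (ℕ.≮⇒≥ n≮2p)

  ^-∣-inv : ∀ f → (∀ j → d ^ suc (j / p) ∣ f (suc j)) → ∀ n → d ^ (n / p) ∣ inv f n
  ^-∣-inv f f-divisible = <-rec P step
    where
    P : ℕ → Set
    P n = d ^ (n / p) ∣ inv f n

    step : ∀ n → (∀ {m} → m < n → P m) → P n
    step zero    rec = subst (λ k → d ^ k ∣ + 1) (sym (0/n≡0 p)) (divides (+ 1) refl)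
    step (suc n) rec = subst (d ^ (suc n / p) ∣_) (sym (inv-suc f n))
      (∣m⇒∣-m (∣-sumTo (suc n) _ λ {j} j<1+n → ∣n⇒∣m*n (+ (suc n C suc j)) (term (ℕ.≤-pred j<1+n))))
      where
      term : ∀ {j} → j ≤ n → d ^ (suc n / p) ∣ f (suc j) * inv f (n ∸ j)
      term {j} j≤n = ^-∣-weaken d bound
        (^-∣-* d (suc (j / p)) ((n ∸ j) / p) (f-divisible j) (rec (s≤s (ℕ.m∸n≤m n j))))
        where
        bound : suc n / p ≤ suc (j / p) ℕ.+ (n ∸ j) / p
        bound = subst (λ k → suc k / p ≤ suc (j / p) ℕ.+ (n ∸ j) / p) (ℕ.m+[n∸m]≡n j≤n)
                      ([1+m+n]/p≤1+m/p+n/p p j (n ∸ j))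

pos-^ : ∀ m n → + (m ℕ.^ n) ≡ (+ m) ^ n
pos-^ m zero    = refl
pos-^ m (suc n) = trans (ℤ.pos-* m (m ℕ.^ n)) (cong (_*_ (+ m)) (pos-^ m n))

nth-applyUpTo : ∀ (s : ℕ → ℤ) {N n} → n < N → nth (applyUpTo s N) n ≡ s n
nth-applyUpTo s {suc N} {zero}  _         = refl
nth-applyUpTo s {suc N} {suc n} (s≤s n<N) = nth-applyUpTo (λ k → s (suc k)) n<N

nth-applyUpTo-beyond : ∀ (s : ℕ → ℤ) {N n} → N ≤ n → nth (applyUpTo s N) n ≡ + 0
nth-applyUpTo-beyond s {zero}          _         = refl
nth-applyUpTo-beyond s {suc N} {suc n} (s≤s N≤n) = nth-applyUpTo-beyond (λ k → s (suc k)) N≤n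

truncation : ∀ (s : EGF) r N → (∀ {n} → N ≤ n → (+ 3) ^ r ∣ s n) →
             ∃ λ (P : List ℤ) → s ≡ poly P [mod3^ r ]
truncation s r N tail = applyUpTo s N , λ n →
  ∣⇒∣ᵤ (subst (_∣ s n - nth (applyUpTo s N) n) (sym (pos-^ 3 r)) (difference n))
  where
  difference : ∀ n → (+ 3) ^ r ∣ s n - nth (applyUpTo s N) n
  difference n with n ℕ.<? N
  ... | yes n<N rewrite nth-applyUpTo s n<N | ℤ.+-inverseʳ (s n) =
    divides (+ 0) (sym (ℤ.*-zeroˡ ((+ 3) ^ r)))
  ... | no  n≮N rewrite nth-applyUpTo-beyond s (ℕ.≮⇒≥ n≮N) | ℤ.+-identityʳ (s n) =
    tail (ℕ.≮⇒≥ n≮N)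

H-cong-% : ∀ m n → m % 6 ≡ n % 6 → H m ≡ H n
H-cong-% m n eq with m % 6 | n % 6
... | zero  | zero  = refl
... | suc _ | suc _ = refl
H-cong-% m n () | zero  | suc _
H-cong-% m n () | suc _ | zero

H-periodic : iterate deriv H 6 ≗ H
H-periodic n = H-cong-% (6 ℕ.+ n) n (trans (cong (_% 6) (ℕ.+-comm 6 n)) ([m+n]%n≡m%n n 6))

T F G : EGF
T = deriv³ H
F = T ⊛ T ⊝ H ⊛ H
G = H ⊛ H ⊛ H ⊕ (+ 3) · (H ⊛ T ⊛ T)

open Monomials H 6 H-periodic

F-tensor : Tensor 6 2
F-tensor = basis (# 3 ∷ # 3 ∷ []) ⊞ (- + 1) ⊠ basis (# 0 ∷ # 0 ∷ [])

-- All three orderings of H T T are needed: the relation G-tensor-relation holds for this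
-- symmetric tensor but not for basis (# 3 ∷ # 3 ∷ # 0 ∷ []) with coefficient 3.
G-tensor : Tensor 6 3
G-tensor = basis (# 0 ∷ # 0 ∷ # 0 ∷ []) ⊞ basis (# 3 ∷ # 3 ∷ # 0 ∷ [])
         ⊞ basis (# 3 ∷ # 0 ∷ # 3 ∷ []) ⊞ basis (# 0 ∷ # 3 ∷ # 3 ∷ [])

eval-F-tensor : eval 2 F-tensor ≗ F
eval-F-tensor n = begin
  eval 2 F-tensor n
    ≡⟨ eval-⊞ 2 (basis (# 3 ∷ # 3 ∷ [])) ((- + 1) ⊠ basis (# 0 ∷ # 0 ∷ [])) n ⟩
  eval 2 (basis (# 3 ∷ # 3 ∷ [])) n + eval 2 ((- + 1) ⊠ basis (# 0 ∷ # 0 ∷ [])) n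
    ≡⟨ cong₂ _+_ (eval-basis₂ (# 3) (# 3) n)
                 (trans (eval-⊠ 2 (- + 1) (basis (# 0 ∷ # 0 ∷ [])) n)
                        (cong (_*_ (- + 1)) (eval-basis₂ (# 0) (# 0) n))) ⟩
  (T ⊛ T) n + - + 1 * (H ⊛ H) n
    ≡⟨ minus ((T ⊛ T) n) ((H ⊛ H) n) ⟩
  F n ∎
  where
  open ≡-Reasoning
  minus : ∀ x y → x + - + 1 * y ≡ x - y
  minus = solve-∀

eval-G-tensor : eval 3 G-tensor ≗ G
eval-G-tensor n = begin
  eval 3 (b₁ ⊞ b₂ ⊞ b₃ ⊞ b₄) n
    ≡⟨ eval-⊞ 3 (b₁ ⊞ b₂ ⊞ b₃) b₄ n ⟩
  eval 3 (b₁ ⊞ b₂ ⊞ b₃) n + eval 3 b₄ n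
    ≡⟨ cong (_+ eval 3 b₄ n) (trans (eval-⊞ 3 (b₁ ⊞ b₂) b₃ n) (cong (_+ eval 3 b₃ n) (eval-⊞ 3 b₁ b₂ n))) ⟩
  eval 3 b₁ n + eval 3 b₂ n + eval 3 b₃ n + eval 3 b₄ n
    ≡⟨ cong₂ _+_ (cong₂ _+_ (cong₂ _+_ (eval-basis₃ (# 0) (# 0) (# 0) n) (eval-basis₃ (# 0) (# 3) (# 3) n))
                           (eval-basis₃ (# 3) (# 0) (# 3) n))
                 (eval-basis₃ (# 3) (# 3) (# 0) n) ⟩
  (H ⊛ H ⊛ H) n + (H ⊛ T ⊛ T) n + (T ⊛ H ⊛ T) n + (T ⊛ T ⊛ H) n
    ≡⟨ cong₂ (λ x y → (H ⊛ H ⊛ H) n + (H ⊛ T ⊛ T) n + x + y)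
             (⊛-congˡ T (⊛-comm T H) n) (trans (⊛-comm (T ⊛ T) H n) (sym (⊛-assoc H T T n))) ⟩
  (H ⊛ H ⊛ H) n + (H ⊛ T ⊛ T) n + (H ⊛ T ⊛ T) n + (H ⊛ T ⊛ T) n
    ≡⟨ collect ((H ⊛ H ⊛ H) n) ((H ⊛ T ⊛ T) n) ⟩
  G n ∎
  where
  open ≡-Reasoning
  b₁ = basis (# 0 ∷ # 0 ∷ # 0 ∷ [])
  b₂ = basis (# 3 ∷ # 3 ∷ # 0 ∷ [])
  b₃ = basis (# 3 ∷ # 0 ∷ # 3 ∷ [])
  b₄ = basis (# 0 ∷ # 3 ∷ # 3 ∷ [])
  collect : ∀ x y → x + y + y + y ≡ x + + 3 * y
  collect = solve-∀

-- Both relations are decided by one evaluation of _≟ᵀ_, which shares the intermediate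
-- tensors; checking them by refl would recompute each iterate once per entry compared.
F-tensor-relation : iterate (derivᵀ 2) F-tensor 13
                  ≡ (- + 27) ⊠ iterate (derivᵀ 2) F-tensor 7 ⊞ + 0 ⊠ iterate (derivᵀ 2) F-tensor 1
F-tensor-relation = toWitness {a? = _ ≟ᵀ _} tt

G-tensor-relation : iterate (derivᵀ 3) G-tensor 13
                  ≡ + 702 ⊠ iterate (derivᵀ 3) G-tensor 7 ⊞ + 19683 ⊠ iterate (derivᵀ 3) G-tensor 1
G-tensor-relation = toWitness {a? = _ ≟ᵀ _} tt

F-recurrence : ∀ n → F (13 ℕ.+ n) ≡ - + 27 * F (7 ℕ.+ n) + + 0 * F (1 ℕ.+ n)
F-recurrence = recurrence-from-tensor 2 F-tensor eval-F-tensor 13 7 1 (- + 27) (+ 0) F-tensor-relation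

G-recurrence : ∀ n → G (13 ℕ.+ n) ≡ + 702 * G (7 ℕ.+ n) + + 19683 * G (1 ℕ.+ n)
G-recurrence = recurrence-from-tensor 3 G-tensor eval-G-tensor 13 7 1 (+ 702) (+ 19683) G-tensor-relation

F-divisible : ∀ n → (+ 3) ^ (n / 6) ∣ F (suc n)
F-divisible = ^-∣-second-order-recurrence (+ 3) 6 0 (λ n → F (suc n)) (- + 27) (+ 0)
  (divides (- + 9) refl) (divides (+ 0) refl) F-recurrence
  (toWitness {a? = ℕ.allUpTo? (λ n → (+ 3) ^ (n / 6) ∣? F (suc n)) 12} tt)

G-divisible : ∀ n → (+ 3) ^ (2 ℕ.+ n / 6) ∣ G (suc n)
G-divisible = ^-∣-second-order-recurrence (+ 3) 6 2 (λ n → G (suc n)) (+ 702) (+ 19683)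
  (divides (+ 234) refl) (divides (+ 2187) refl) G-recurrence
  (toWitness {a? = ℕ.allUpTo? (λ n → (+ 3) ^ (2 ℕ.+ n / 6) ∣? G (suc n)) 12} tt)

inv-G-divisible : ∀ n → (+ 3) ^ (n / 6) ∣ inv G n
inv-G-divisible = ^-∣-inv (+ 3) 6 G (λ j → ^-∣-weaken (+ 3) (ℕ.n≤1+n (suc (j / 6))) (G-divisible j))

lemma3p13 : (r : ℕ) → 0 < r →
    (∃ λ (P : List _) →
      (deriv³ H ⊛ deriv³ H ⊝ H ⊛ H) ≡ poly P [mod3^ r ])
    ×
    (∃ λ (Q : List _) →
      inv (H ⊛ H ⊛ H ⊕ (+ 3) · (H ⊛ deriv³ H ⊛ deriv³ H)) ≡ poly Q [mod3^ r ])
lemma3p13 r _ = truncation F r (suc (r ℕ.* 6)) F-tail , truncation (inv G) r (r ℕ.* 6) inv-G-tail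
  where
  F-tail : ∀ {n} → suc (r ℕ.* 6) ≤ n → (+ 3) ^ r ∣ F n
  F-tail {suc n} (s≤s r*6≤n) = ^-∣-weaken (+ 3) (m*p≤n⇒m≤n/p 6 r r*6≤n) (F-divisible n)
  inv-G-tail : ∀ {n} → r ℕ.* 6 ≤ n → (+ 3) ^ r ∣ inv G n
  inv-G-tail {n} r*6≤n = ^-∣-weaken (+ 3) (m*p≤n⇒m≤n/p 6 r r*6≤n) (inv-G-divisible n)
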